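{- If a collection $\mathcal C$ is uniformly generatable without repetition, then $\mathcal C$ is uniformly generatable with repetitions.
   Context: A language is an infinite subset of a countably infinite universe $U$; a collection is a set of languages. A generator is an arbitrary function $G$ from finite sequences in $U$ to $U$, with output $z_t=G(x_0,\dots,x_t)$; $S_t=\{x_0,\dots,x_t\}$. Uniform generation without repetition: there is $t^\star$ such that for every $K\in\mathcal C$, every infinite sequence $x_0,x_1,\dots$ of pairwise distinct elements of $K$ containing every element of $K$, and every $t\ge t^\star$, $z_t\in K\setminus S_t$. Uniform generation with repetitions: there is $d^\star$ such that for every $K\in\mathcal C$ and every sequence $x_0,x_1,\dots$ (repetitions allowed) with $\bigcup_t\{x_t\}=K$, $z_t\in K\setminus S_t$ for all $t$ with $|S_t|\ge d^\star$. A collection has the property if some $G$ achieves it. -}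

module Defs where

open import Data.Nat using (ℕ; suc; _≤_; _≥_)
open import Data.Fin using (Fin)
open import Data.List using (List)
open import Data.List.Base using (tabulate)
open import Data.List.Membership.Propositional using (_∉_)
open import Data.Product using (Σ; _×_; ∃)
open import Function.Bundles using (_↔_)
open import Relation.Binary.PropositionalEquality using (_≡_; _≢_)
open import Relation.Nullary using (¬_)

CountablyInfinite : Set → Set
CountablyInfinite U = U ↔ ℕ

Infinite : {U : Set} → (U → Set) → Set
Infinite {U} K = (l : List U) → Σ U λ y → K y × y ∉ l

-- A language is an infinite subset; a collection is a set of languages.
-- We represent a collection as a predicate on subsets, each member infinite.
IsCollection : {U : Set} → ((U → Set) → Set) → Set₁
IsCollection {U} C = (K : U → Set) → C K → Infinite K

Generator : Set → Set
Generator U = List U → U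

prefix : {U : Set} → (ℕ → U) → ℕ → List U
prefix x t = tabulate {n = suc t} (λ i → x (Data.Fin.toℕ i))

out : {U : Set} → Generator U → (ℕ → U) → ℕ → U
out G x t = G (prefix x t)

InKMinusS : {U : Set} → (U → Set) → (ℕ → U) → ℕ → U → Set
InKMinusS K x t z = K z × ((i : ℕ) → i ≤ t → z ≢ x i)

Enumerates : {U : Set} → (ℕ → U) → (U → Set) → Set
Enumerates {U} x K = ((t : ℕ) → K (x t)) × ((y : U) → K y → ∃ λ t → x t ≡ y)

PairwiseDistinct : {U : Set} → (ℕ → U) → Set
PairwiseDistinct x = (i j : ℕ) → x i ≡ x j → i ≡ j

CardAtLeast : {U : Set} → (ℕ → U) → ℕ → ℕ → Set
CardAtLeast x t d =
  Σ (Fin d → ℕ) λ f → ((i : Fin d) → f i ≤ t) × ((i j : Fin d) → x (f i) ≡ x (f j) → i ≡ j)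

UniformWithoutRepetition : {U : Set} → ((U → Set) → Set) → Set₁
UniformWithoutRepetition {U} C =
  Σ (Generator U) λ G → Σ ℕ λ tstar →
    (K : U → Set) → C K → (x : ℕ → U) → PairwiseDistinct x → Enumerates x K →
    (t : ℕ) → t ≥ tstar → InKMinusS K x t (out G x t)

UniformWithRepetitions : {U : Set} → ((U → Set) → Set) → Set₁
UniformWithRepetitions {U} C =
  Σ (Generator U) λ G → Σ ℕ λ dstar →
    (K : U → Set) → C K → (x : ℕ → U) → Enumerates x K →
    (t : ℕ) → CardAtLeast x t dstar → InKMinusS K x t (out G x t)

-- Run G on the deduplicated input, with threshold t⋆ + 1. If x₀ … x_t has at least t⋆ + 1
-- distinct elements, list them without repetition as D and extend D to a repetition-free
-- enumeration of K: keep each later x_k that is new and otherwise insert a fresh element of K,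
-- which exists because K is infinite. This enumeration begins with D at a time ≥ t⋆, so G(D)
-- lies in K outside D, and D contains all of x₀ … x_t.

module Submission where

open import Defs
open import Data.Nat using (ℕ; zero; suc; _+_; _∸_; _≤_; _<_; _≥_; s≤s; _<?_)
  renaming (_≟_ to _≟ℕ_)
open import Data.Nat.Properties
  using (m<1+n⇒m<n∨m≡n; m<1+n⇒m≤n; m+n∸m≡n; m+[n∸m]≡n; <⇒≱; ≮⇒≥; m≤m+n; <-cmp)
open import Data.Fin using (Fin; zero; suc; toℕ; fromℕ<)
open import Data.Fin.Properties using (toℕ<n; fromℕ<-toℕ; toℕ-fromℕ<; injective⇒≤)
open import Data.List using (List; _∷_; length; lookup; deduplicate)
open import Data.List.Properties using (tabulate-cong; tabulate-lookup)
open import Data.List.Membership.Propositional using (_∈_; _∉_)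
open import Data.List.Membership.Propositional.Properties using (∈-lookup; ∈-tabulate⁺; ∈-deduplicate⁺)
import Data.List.Membership.DecPropositional as DecMembership
open import Data.List.Relation.Unary.Any using (here; there; index)
open import Data.List.Relation.Unary.Any.Properties using (lookup-index)
open import Data.List.Relation.Unary.All as All using (All)
open import Data.List.Relation.Unary.All.Properties using (tabulate⁺; deduplicate⁺)
open import Data.List.Relation.Unary.AllPairs using (_∷_)
open import Data.List.Relation.Unary.Unique.Propositional using (Unique)
open import Data.List.Relation.Unary.Unique.DecPropositional.Properties using (deduplicate-!)
open import Data.Product using (_,_; proj₁; proj₂; ∃)
open import Data.Sum using (_⊎_; inj₁; inj₂)
open import Function using (_∘_)
open import Function.Properties.Inverse using (↔⇒↣)
open import Relation.Binary.Definitions using (DecidableEquality; tri<; tri≈; tri>)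
open import Relation.Binary.PropositionalEquality using (_≡_; _≢_; refl; sym; trans; cong; subst; module ≡-Reasoning)
open import Relation.Nullary using (yes; no)
open import Relation.Nullary.Decidable using (via-injection)
open import Relation.Nullary.Negation using (contradiction)

countablyInfinite⇒≟ : {U : Set} → CountablyInfinite U → DecidableEquality U
countablyInfinite⇒≟ U↔ℕ = via-injection (↔⇒↣ U↔ℕ) _≟ℕ_

lookup-injective : {U : Set} {D : List U} → Unique D →
                   (i j : Fin (length D)) → lookup D i ≡ lookup D j → i ≡ j
lookup-injective {D = _ ∷ _} _            zero    zero    _  = refl
lookup-injective {D = _ ∷ _} (d∉ds ∷ _)   zero    (suc j) eq = contradiction eq (All.lookup d∉ds (∈-lookup j))
lookup-injective {D = _ ∷ _} (d∉ds ∷ _)   (suc i) zero    eq = contradiction (sym eq) (All.lookup d∉ds (∈-lookup i))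
lookup-injective {D = _ ∷ _} (_ ∷ unique) (suc i) (suc j) eq = cong suc (lookup-injective unique i j eq)

<-distinct⇒pairwiseDistinct : {U : Set} {x : ℕ → U} →
                              (∀ {i j} → i < j → x i ≢ x j) → PairwiseDistinct x
<-distinct⇒pairwiseDistinct distinct i j eq with <-cmp i j
... | tri< i<j _ _ = contradiction eq (distinct i<j)
... | tri≈ _ i≡j _ = i≡j
... | tri> _ _ j<i = contradiction (sym eq) (distinct j<i)

below-or-above : (m n : ℕ) → (∃ λ (i : Fin m) → toℕ i ≡ n) ⊎ (∃ λ k → m + k ≡ n)
below-or-above m n with n <? m
... | yes n<m = inj₁ (fromℕ< n<m , toℕ-fromℕ< n<m)
... | no n≮m  = inj₂ (n ∸ m , m+[n∸m]≡n (≮⇒≥ n≮m))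

∈-prefix : {U : Set} (x : ℕ → U) {t i : ℕ} → i ≤ t → x i ∈ prefix x t
∈-prefix x {t} i≤t = subst (_∈ prefix x t) (cong x (toℕ-fromℕ< (s≤s i≤t)))
                          (∈-tabulate⁺ {f = x ∘ toℕ} (fromℕ< (s≤s i≤t)))

prefix-All : {U : Set} {P : U → Set} {x : ℕ → U} → (∀ i → P (x i)) → ∀ t → All P (prefix x t)
prefix-All P∘x t = tabulate⁺ {n = suc t} (P∘x ∘ toℕ)

prefix-lookup : {U : Set} {x : ℕ → U} {d : U} {ds : List U} →
                ((i : Fin (length (d ∷ ds))) → x (toℕ i) ≡ lookup (d ∷ ds) i) →
                prefix x (length ds) ≡ d ∷ ds
prefix-lookup {ds = ds} x≡lookup = trans (tabulate-cong x≡lookup) (tabulate-lookup (_ ∷ ds))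

cardAtLeast⇒≤length : {U : Set} {x : ℕ → U} {t d : ℕ} {L : List U} →
                      CardAtLeast x t d → (∀ i → i ≤ t → x i ∈ L) → d ≤ length L
cardAtLeast⇒≤length {x = x} {L = L} (f , f≤t , x∘f-injective) S⊆L =
  injective⇒≤ {f = position} λ {i} {j} eq → x∘f-injective i j (begin
    x (f i)                   ≡⟨ lookup-index (S⊆L (f i) (f≤t i)) ⟩
    lookup L (position i)     ≡⟨ cong (lookup L) eq ⟩
    lookup L (position j)     ≡⟨ lookup-index (S⊆L (f j) (f≤t j)) ⟨
    x (f j)                   ∎)
  where
  open ≡-Reasoning
  position : Fin _ → Fin (length L)
  position i = index (S⊆L (f i) (f≤t i))

module DistinctExtension {U : Set} (_≟_ : DecidableEquality U) {K : U → Set} (K-infinite : Infinite K)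
                         {x : ℕ → U} (x-enumerates : Enumerates x K)
                         {D : List U} (D-unique : Unique D) (D⊆K : All K D) where

  open DecMembership _≟_ using (_∈?_)

  m : ℕ
  m = length D

  next : ℕ → List U → U
  next k seen with x k ∈? seen
  ... | yes _ = proj₁ (K-infinite seen)
  ... | no  _ = x k

  next∉ : ∀ k seen → next k seen ∉ seen
  next∉ k seen with x k ∈? seen
  ... | yes _  = proj₂ (proj₂ (K-infinite seen))
  ... | no  x∉ = x∉

  next∈K : ∀ k seen → K (next k seen)
  next∈K k seen with x k ∈? seen
  ... | yes _ = proj₁ (proj₂ (K-infinite seen))
  ... | no  _ = proj₁ x-enumerates k

  next-covers : ∀ k seen → x k ∈ seen ⊎ next k seen ≡ x k
  next-covers k seen with x k ∈? seen
  ... | yes x∈ = inj₁ x∈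
  ... | no  _  = inj₂ refl

  seen : ℕ → List U
  new : ℕ → U
  seen zero    = D
  seen (suc k) = new k ∷ seen k
  new k = next k (seen k)

  D⊆seen : ∀ k {y} → y ∈ D → y ∈ seen k
  D⊆seen zero    y∈D = y∈D
  D⊆seen (suc k) y∈D = there (D⊆seen k y∈D)

  new∈seen : ∀ {j k} → j < k → new j ∈ seen k
  new∈seen {j} {suc k} j<1+k with m<1+n⇒m<n∨m≡n j<1+k
  ... | inj₁ j<k  = there (new∈seen j<k)
  ... | inj₂ refl = here refl

  seen⊆D∪new : ∀ k {y} → y ∈ seen k → y ∈ D ⊎ ∃ λ j → y ≡ new j
  seen⊆D∪new zero    y∈D         = inj₁ y∈D
  seen⊆D∪new (suc k) (here y≡new) = inj₂ (k , y≡new)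
  seen⊆D∪new (suc k) (there y∈)  = seen⊆D∪new k y∈

  new-injective : PairwiseDistinct new
  new-injective = <-distinct⇒pairwiseDistinct λ {j} {k} j<k eq →
    next∉ k (seen k) (subst (_∈ seen k) eq (new∈seen j<k))

  new∉D : ∀ k → new k ∉ D
  new∉D k = next∉ k (seen k) ∘ D⊆seen k

  extension : ℕ → U
  extension n with n <? m
  ... | yes n<m = lookup D (fromℕ< n<m)
  ... | no  _   = new (n ∸ m)

  extension-below : (i : Fin m) → extension (toℕ i) ≡ lookup D i
  extension-below i with toℕ i <? m
  ... | yes i<m = cong (lookup D) (fromℕ<-toℕ i i<m)
  ... | no  i≮m = contradiction (toℕ<n i) i≮m

  extension-above : ∀ k → extension (m + k) ≡ new k
  extension-above k with m + k <? m
  ... | yes m+k<m = contradiction (m≤m+n m k) (<⇒≱ m+k<m)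
  ... | no  _     = cong new (m+n∸m≡n m k)

  below≢above : ∀ i k → extension (toℕ i) ≢ extension (m + k)
  below≢above i k eq =
    new∉D k (subst (_∈ D) (trans (sym (extension-below i)) (trans eq (extension-above k))) (∈-lookup i))

  extension-distinct : PairwiseDistinct extension
  extension-distinct n n′ eq with below-or-above m n | below-or-above m n′
  ... | inj₁ (i , refl) | inj₁ (i′ , refl) =
    cong toℕ (lookup-injective D-unique i i′
      (trans (sym (extension-below i)) (trans eq (extension-below i′))))
  ... | inj₁ (i , refl) | inj₂ (k , refl) = contradiction eq (below≢above i k)
  ... | inj₂ (k , refl) | inj₁ (i , refl) = contradiction (sym eq) (below≢above i k)
  ... | inj₂ (k , refl) | inj₂ (k′ , refl) =
    cong (m +_) (new-injective k k′ (trans (sym (extension-above k)) (trans eq (extension-above k′))))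

  extension∈K : ∀ n → K (extension n)
  extension∈K n with below-or-above m n
  ... | inj₁ (i , refl) = subst K (sym (extension-below i)) (All.lookup D⊆K (∈-lookup i))
  ... | inj₂ (k , refl) = subst K (sym (extension-above k)) (next∈K k (seen k))

  Listed : U → Set
  Listed y = ∃ λ n → extension n ≡ y

  D-listed : ∀ {y} → y ∈ D → Listed y
  D-listed y∈D = toℕ (index y∈D) , trans (extension-below (index y∈D)) (sym (lookup-index y∈D))

  seen-listed : ∀ k {y} → y ∈ seen k → Listed y
  seen-listed k y∈seen with seen⊆D∪new k y∈seen
  ... | inj₁ y∈D        = D-listed y∈D
  ... | inj₂ (j , refl) = m + j , extension-above j

  x-listed : ∀ t → Listed (x t)
  x-listed t with next-covers t (seen t)
  ... | inj₁ x∈seen = seen-listed t x∈seen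
  ... | inj₂ new≡x  = m + t , trans (extension-above t) new≡x

  extension-enumerates : Enumerates extension K
  extension-enumerates = extension∈K , λ y y∈K →
    let (t , xt≡y) = proj₂ x-enumerates y y∈K
        (n , eq)   = x-listed t
    in n , trans eq xt≡y

generates-on-unique-cover :
  {U : Set} → DecidableEquality U → {K : U → Set} → Infinite K → (G : Generator U) (tstar : ℕ) →
  ((x′ : ℕ → U) → PairwiseDistinct x′ → Enumerates x′ K →
     (t : ℕ) → t ≥ tstar → InKMinusS K x′ t (out G x′ t)) →
  {x : ℕ → U} → Enumerates x K → {t : ℕ} {D : List U} →
  Unique D → All K D → (∀ i → i ≤ t → x i ∈ D) → suc tstar ≤ length D →
  InKMinusS K x t (G D)
generates-on-unique-cover _≟_ {K} K-infinite G tstar G-generates {x} x-enumerates {t} {d ∷ ds}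
                          D-unique D⊆K S⊆D (s≤s tstar≤|ds|) = proj₁ generated , avoids
  where
  open DistinctExtension _≟_ K-infinite x-enumerates D-unique D⊆K

  generated : InKMinusS K extension (length ds) (G (d ∷ ds))
  generated = subst (InKMinusS K extension (length ds) ∘ G) (prefix-lookup {x = extension} extension-below)
                    (G-generates extension extension-distinct extension-enumerates (length ds) tstar≤|ds|)

  avoids : ∀ i → i ≤ t → G (d ∷ ds) ≢ x i
  avoids i i≤t G≡x = proj₂ generated (toℕ j) (m<1+n⇒m≤n (toℕ<n j))
                       (trans G≡x (trans (lookup-index xi∈D) (sym (extension-below j))))
    where
    xi∈D : x i ∈ d ∷ ds
    xi∈D = S⊆D i i≤t
    j : Fin m
    j = index xi∈D

lemmaA1 : (U : Set) → CountablyInfinite U → (C : (U → Set) → Set) → IsCollection C →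
          UniformWithoutRepetition C → UniformWithRepetitions C
lemmaA1 U U↔ℕ C C-infinite (G , tstar , G-generates) =
  G ∘ deduplicate _≟_ , suc tstar , λ K K∈C x x-enumerates t |S|≥ →
    let S⊆D : ∀ i → i ≤ t → x i ∈ deduplicate _≟_ (prefix x t)
        S⊆D i i≤t = ∈-deduplicate⁺ _≟_ (∈-prefix x i≤t)
    in generates-on-unique-cover _≟_ (C-infinite K K∈C) G tstar (G-generates K K∈C) x-enumerates
         (deduplicate-! _≟_ (prefix x t))
         (deduplicate⁺ _≟_ (prefix-All (proj₁ x-enumerates) t))
         S⊆D (cardAtLeast⇒≤length |S|≥ S⊆D)
  where
  _≟_ : DecidableEquality U
  _≟_ = countablyInfinite⇒≟ U↔ℕ
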